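{- Let $\psi$ be a reduced function. Then $\delta(\psi)<2$ if and only if there exists an integer $B$ such that, for all sufficiently large $i$, $\psi(i)\in\mathbb{N}^*$ and $\psi(i)\ge i-B$.
   Context: $\mathcal{A}$ is an alphabet disjoint from $\mathbb{N}^*=\{1,2,\dots\}$. A function here is a map $\psi:\mathbb{N}^*\to\mathbb{N}^*\sqcup\mathcal{A}$ with, for each $n\ge1$, either $\psi(n)\in\mathcal{A}$ or $1\le\psi(n)\le n-1$. Let $(t_k)_{k\ge0}$ be the (finite or infinite) increasing enumeration of all $n\ge1$ with $1\le\psi(n)\le n-2$ or $\psi(n)\in\mathcal{A}$. $\psi$ is reduced if for every $k\ge1$ such that $t_k$ exists: $\psi(t_k)\ne\psi(t_{k-1})$, and either $\psi(t_k)\in\mathcal{A}$ or $\psi(t_k)<t_{k-1}$. For reduced $\psi$, let $n_1=0$ and $n_{i+1}=2n_i-n_{\psi(i)}$ if $\psi(i)\in\mathbb{N}^*$, $n_{i+1}=2n_i+1$ if $\psi(i)\in\mathcal{A}$; $\delta(\psi)=\limsup_{i\to\infty} n_{i+1}/n_i$. -}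

module Defs where

open import Data.Nat as ℕ using (ℕ; zero; suc; _∸_)
open import Data.Integer as ℤ using (ℤ; +_)
open import Data.List using (List; []; _∷_; _++_)
open import Data.Sum using (_⊎_; inj₁; inj₂)
open import Data.Product using (Σ; ∃; ∃-syntax; _×_; _,_)
open import Relation.Binary.PropositionalEquality using (_≡_)
open import Relation.Nullary using (¬_)

-- A "function" ψ : ℕ* → ℕ* ⊔ 𝒜 is modelled as ψ : ℕ → 𝒜 ⊎ ℕ, where only the
-- arguments n ≥ 1 are meaningful (ψ 0 is ignored everywhere).
Fun : Set → Set
Fun A = ℕ → A ⊎ ℕ

ValidValue : {A : Set} → ℕ → A ⊎ ℕ → Set
ValidValue n (inj₁ a) = Data.Unit.⊤ where import Data.Unit
ValidValue n (inj₂ m) = 1 ℕ.≤ m × m ℕ.≤ n ∸ 1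

IsFunction : {A : Set} → Fun A → Set
IsFunction ψ = ∀ n → 1 ℕ.≤ n → ValidValue n (ψ n)

InT : {A : Set} → Fun A → ℕ → Set
InT ψ n = 1 ℕ.≤ n × (∃[ a ] ψ n ≡ inj₁ a ⊎ ∃[ m ] (ψ n ≡ inj₂ m × 1 ℕ.≤ m × m ℕ.≤ n ∸ 2))

Consecutive : {A : Set} → Fun A → ℕ → ℕ → Set
Consecutive ψ s t = InT ψ s × InT ψ t × s ℕ.< t × (∀ j → s ℕ.< j → j ℕ.< t → ¬ InT ψ j)

BelowPrev : {A : Set} → ℕ → A ⊎ ℕ → Set
BelowPrev s (inj₁ a) = Data.Unit.⊤ where import Data.Unit
BelowPrev s (inj₂ m) = m ℕ.< s

Reduced : {A : Set} → Fun A → Set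
Reduced ψ = IsFunction ψ ×
  (∀ s t → Consecutive ψ s t → ¬ (ψ t ≡ ψ s) × BelowPrev s (ψ t))

-- list lookup with default 0 (0-based index)
get : List ℤ → ℕ → ℤ
get [] _ = + 0
get (x ∷ _) zero = x
get (_ ∷ xs) (suc k) = get xs k

-- next value n_{i+1} from l = [n_1, …, n_i], n_i and ψ(i)
step : {A : Set} → List ℤ → ℤ → A ⊎ ℕ → ℤ
step l ni (inj₁ _) = + 2 ℤ.* ni ℤ.+ + 1
step l ni (inj₂ m) = + 2 ℤ.* ni ℤ.- get l (m ∸ 1)

-- seqL ψ k = [n_1, …, n_k]
seqL : {A : Set} → Fun A → ℕ → List ℤ
seqL ψ zero = []
seqL ψ (suc zero) = + 0 ∷ []
seqL ψ (suc (suc k)) =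
  let l = seqL ψ (suc k) in l ++ (step l (get l k) (ψ (suc k)) ∷ [])

-- nseq ψ i = n_i   (for i ≥ 1; n_1 = 0)
nseq : {A : Set} → Fun A → ℕ → ℤ
nseq ψ i = get (seqL ψ i) (i ∸ 1)

-- δ(ψ) = limsup n_{i+1}/n_i < 2, unfolded: there is a rational p/q < 2 such that
-- for all sufficiently large i, n_i > 0 (so the ratio is defined) and n_{i+1}/n_i ≤ p/q.
DeltaLt2 : {A : Set} → Fun A → Set
DeltaLt2 ψ = ∃[ p ] ∃[ q ] (p ℕ.< 2 ℕ.* q × ∃[ N ] (∀ i → N ℕ.≤ i →
  (+ 0 ℤ.< nseq ψ i × + q ℤ.* nseq ψ (suc i) ℤ.≤ + p ℤ.* nseq ψ i)))

EventuallyClose : {A : Set} → Fun A → Set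
EventuallyClose ψ = ∃[ B ] ∃[ N ] (∀ i → N ℕ.≤ i →
  ∃[ m ] (ψ i ≡ inj₂ m × (+ i ℤ.- B) ℤ.≤ + m))

-- With d_i = n_{i+1} - n_i, the increment d_{i+1} - d_i is n_i + 1 or n_i - n_{ψ(i+1)} with
-- ψ(i+1) ≤ i, so n is nondecreasing and convex, and d_i ≥ d_1 = 1 for i ≥ 1.  Reducedness adds
-- the invariant n_{t-1} ≤ d_t at every t = t_k: if ψ(t) ∈ ℕ* then ψ(t) < t_{k-1}, so
-- d_t = n_{t-1} + d_{t-1} - n_{ψ(t)} with n_{ψ(t)} ≤ n_{t_{k-1} - 1} ≤ d_{t_{k-1}} ≤ d_{t-1}.
--
-- (⇒) If q n_{i+1} ≤ p n_i with p < 2q for i ≥ N, then ψ(i) ∈ ℕ* and n_i ≤ q n_{ψ(i)}.  For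
-- large j = t_k with m = ψ(j) ≥ N, take consecutive t ≤ m < u in (t_k); convexity gives
-- (u - t) d_t ≤ n_u ≤ q n_{ψ(u)} ≤ q n_{t-1} ≤ q d_t as ψ(u) < t, so u - t ≤ q and
-- n_m ≤ n_t + (m - t) d_m ≤ (q + 2) d_m; then (j - m) d_m ≤ n_j ≤ q (q + 2) d_m.
-- Off (t_k), ψ(j) = j - 1.
-- (⇐) n_{i+1} ≤ 3 n_i for i ≥ 2, so ψ(i) = m ≥ i - b gives n_i ≤ 3^b n_m and therefore
-- 3^b n_{i+1} = 2 · 3^b n_i - 3^b n_m ≤ (2 · 3^b - 1) n_i.

module Submission where

open import Defs
open import Function.Bundles using (_⇔_; mk⇔)
open import Data.Nat as ℕ using (ℕ; zero; suc; _∸_; _^_; z≤n; s≤s)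
import Data.Nat.Properties as ℕP
open import Data.Nat.Induction using (<-rec)
open import Data.Integer as ℤ using (ℤ; +_; -[1+_]; _+_; _-_; _*_; -_; _≤_; _<_; +≤+; ∣_∣)
import Data.Integer.Properties as ℤP
open import Data.Integer.Tactic.RingSolver using (solve-∀)
open import Data.List using (List; []; _∷_; _++_; length)
open import Data.List.Properties using (length-++)
open import Data.Sum using (_⊎_; inj₁; inj₂)
open import Data.Sum.Properties using (inj₂-injective)
open import Data.Product using (∃-syntax; ∃₂; _×_; _,_; proj₁; proj₂)
open import Data.Empty using (⊥-elim)
open import Relation.Binary.PropositionalEquality
open import Relation.Nullary using (¬_; Dec; yes; no; _×-dec_)
open import Relation.Unary using (Decidable)

Δ : (ℕ → ℤ) → ℕ → ℤ
Δ f k = f (suc k) - f k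

+Δ≡suc : ∀ f k → f k + Δ f k ≡ f (suc k)
+Δ≡suc f k = x+[y-x]≡y (f k) (f (suc k))
  where
  x+[y-x]≡y : ∀ x y → x + (y - x) ≡ y
  x+[y-x]≡y = solve-∀

[1+p]*x≡p*x+x : ∀ p x → + suc p * x ≡ + p * x + x
[1+p]*x≡p*x+x p x = trans (ℤP.suc-* (+ p) x) (ℤP.+-comm x (+ p * x))

q*[2*x]≡[2q]*x : ∀ q x → + q * (+ 2 * x) ≡ + (2 ℕ.* q) * x
q*[2*x]≡[2q]*x q x = trans (reassociate (+ q) x) (cong (_* x) (sym (ℤP.pos-* 2 q)))
  where
  reassociate : ∀ q x → q * (+ 2 * x) ≡ + 2 * q * x
  reassociate = solve-∀

x+y-y≡x : ∀ x y → x + y - y ≡ x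
x+y-y≡x = solve-∀

i≤+∣i∣ : ∀ i → i ≤ + ∣ i ∣
i≤+∣i∣ (+ _)    = ℤP.≤-refl
i≤+∣i∣ -[1+ _ ] = ℤ.-≤+

+i-B≤+m⇒i≤m+∣B∣ : ∀ {i m} B → + i - B ≤ + m → i ℕ.≤ m ℕ.+ ∣ B ∣
+i-B≤+m⇒i≤m+∣B∣ {i} {m} B i-B≤m = ℤP.drop‿+≤+ (begin
  + i               ≡⟨ x-y+y≡x (+ i) B ⟨
  + i - B + B       ≤⟨ ℤP.+-mono-≤ i-B≤m (i≤+∣i∣ B) ⟩
  + (m ℕ.+ ∣ B ∣)   ∎)
  where
  open ℤP.≤-Reasoning
  x-y+y≡x : ∀ x y → x - y + y ≡ x
  x-y+y≡x = solve-∀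

i≤m+b⇒+i-+b≤+m : ∀ {i m b} → i ℕ.≤ m ℕ.+ b → + i - + b ≤ + m
i≤m+b⇒+i-+b≤+m {i} {m} {b} i≤m+b = begin
  + i - + b             ≤⟨ ℤP.+-monoˡ-≤ (- + b) (+≤+ i≤m+b) ⟩
  + m + + b - + b       ≡⟨ x+y-y≡x (+ m) (+ b) ⟩
  + m                   ∎
  where open ℤP.≤-Reasoning

module ConvexSequence (f : ℕ → ℤ) (Δ-≤-Δ-suc : ∀ k → Δ f k ≤ Δ f (suc k)) where

  Δ-mono : ∀ {a b} → a ℕ.≤ b → Δ f a ≤ Δ f b
  Δ-mono {b = zero} z≤n = ℤP.≤-refl
  Δ-mono {b = suc b} a≤1+b with ℕP.m≤n⇒m<n∨m≡n a≤1+b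
  ... | inj₁ a<1+b = ℤP.≤-trans (Δ-mono (ℕP.≤-pred a<1+b)) (Δ-≤-Δ-suc b)
  ... | inj₂ refl  = ℤP.≤-refl

  private
    open ℤP.≤-Reasoning

    x+r*z+z≡x+[1+r]*z : ∀ x r z → (x + r * z) + z ≡ x + (+ 1 + r) * z
    x+r*z+z≡x+[1+r]*z = solve-∀

    secant-≥′ : ∀ a r → f a + + r * Δ f a ≤ f (r ℕ.+ a)
    secant-≥′ a zero = ℤP.≤-reflexive (ℤP.+-identityʳ (f a))
    secant-≥′ a (suc r) = begin
      f a + + suc r * Δ f a         ≡⟨ x+r*z+z≡x+[1+r]*z (f a) (+ r) (Δ f a) ⟨
      f a + + r * Δ f a + Δ f a     ≤⟨ ℤP.+-mono-≤ (secant-≥′ a r) (Δ-mono (ℕP.m≤n+m a r)) ⟩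
      f (r ℕ.+ a) + Δ f (r ℕ.+ a)   ≡⟨ +Δ≡suc f (r ℕ.+ a) ⟩
      f (suc r ℕ.+ a)               ∎

    secant-≤′ : ∀ a r → f (r ℕ.+ a) ≤ f a + + r * Δ f (r ℕ.+ a)
    secant-≤′ a zero = ℤP.≤-reflexive (sym (ℤP.+-identityʳ (f a)))
    secant-≤′ a (suc r) = begin
      f (suc r ℕ.+ a)                                   ≡⟨ +Δ≡suc f (r ℕ.+ a) ⟨
      f (r ℕ.+ a) + Δ f (r ℕ.+ a)                       ≤⟨ ℤP.+-monoˡ-≤ _ (secant-≤′ a r) ⟩
      f a + + r * Δ f (r ℕ.+ a) + Δ f (r ℕ.+ a)         ≤⟨ ℤP.+-mono-≤ r*Δr≤r*Δ1+r Δr≤Δ1+r ⟩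
      f a + + r * Δ f (suc r ℕ.+ a) + Δ f (suc r ℕ.+ a) ≡⟨ x+r*z+z≡x+[1+r]*z (f a) (+ r) _ ⟩
      f a + + suc r * Δ f (suc r ℕ.+ a)                 ∎
      where
      Δr≤Δ1+r = Δ-≤-Δ-suc (r ℕ.+ a)
      r*Δr≤r*Δ1+r = ℤP.+-monoʳ-≤ (f a) (ℤP.*-monoˡ-≤-nonNeg (+ r) Δr≤Δ1+r)

  secant-≥ : ∀ {a b} → a ℕ.≤ b → f a + + (b ∸ a) * Δ f a ≤ f b
  secant-≥ {a} {b} a≤b =
    subst (λ c → f a + + (b ∸ a) * Δ f a ≤ f c) (ℕP.m∸n+n≡m a≤b) (secant-≥′ a _)

  secant-≤ : ∀ {a b} → a ℕ.≤ b → f b ≤ f a + + (b ∸ a) * Δ f b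
  secant-≤ {a} {b} a≤b =
    subst (λ c → f c ≤ f a + + (b ∸ a) * Δ f c) (ℕP.m∸n+n≡m a≤b) (secant-≤′ a _)

geometric-≤ : ∀ (f : ℕ → ℤ) c {a} → (∀ k → a ℕ.≤ k → f (suc k) ≤ + c * f k) →
              ∀ {b} → a ℕ.≤ b → f b ≤ + (c ^ (b ∸ a)) * f a
geometric-≤ f c {a} ratio {b} a≤b =
  subst (λ x → f x ≤ + (c ^ (b ∸ a)) * f a) (ℕP.m∸n+n≡m a≤b) (geometric′ (b ∸ a))
  where
  open ℤP.≤-Reasoning
  geometric′ : ∀ r → f (r ℕ.+ a) ≤ + (c ^ r) * f a
  geometric′ zero = ℤP.≤-reflexive (sym (ℤP.*-identityˡ (f a)))
  geometric′ (suc r) = begin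
    f (suc r ℕ.+ a)             ≤⟨ ratio (r ℕ.+ a) (ℕP.m≤n+m a r) ⟩
    + c * f (r ℕ.+ a)           ≤⟨ ℤP.*-monoˡ-≤-nonNeg (+ c) (geometric′ r) ⟩
    + c * (+ (c ^ r) * f a)     ≡⟨ ℤP.*-assoc (+ c) (+ (c ^ r)) (f a) ⟨
    + c * + (c ^ r) * f a       ≡⟨ cong (_* f a) (ℤP.pos-* c (c ^ r)) ⟨
    + (c ^ suc r) * f a         ∎

Adjacent : (ℕ → Set) → ℕ → ℕ → Set
Adjacent P s t = P s × P t × s ℕ.< t × (∀ k → s ℕ.< k → k ℕ.< t → ¬ P k)

module BoundedSearch {P : ℕ → Set} (P? : Decidable P) where

  last-≤ : ∀ {a m} → P a → a ℕ.≤ m → ∃[ t ] (t ℕ.≤ m × P t × (∀ k → t ℕ.< k → k ℕ.≤ m → ¬ P k))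
  last-≤ {m = zero} Pa z≤n = zero , z≤n , Pa , λ k 0<k k≤0 → ⊥-elim (ℕP.<⇒≱ 0<k k≤0)
  last-≤ {m = suc m} Pa a≤1+m with P? (suc m) | ℕP.m≤n⇒m<n∨m≡n a≤1+m
  ... | yes P1+m | _ = suc m , ℕP.≤-refl , P1+m , λ k 1+m<k k≤1+m → ⊥-elim (ℕP.<⇒≱ 1+m<k k≤1+m)
  ... | no ¬P1+m | inj₂ refl = ⊥-elim (¬P1+m Pa)
  ... | no ¬P1+m | inj₁ a<1+m with last-≤ Pa (ℕP.≤-pred a<1+m)
  ...   | t , t≤m , Pt , none = t , ℕP.m≤n⇒m≤1+n t≤m , Pt , none′
    where
    none′ : ∀ k → t ℕ.< k → k ℕ.≤ suc m → ¬ P k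
    none′ k t<k k≤1+m with ℕP.m≤n⇒m<n∨m≡n k≤1+m
    ... | inj₁ k<1+m = none k t<k (ℕP.≤-pred k<1+m)
    ... | inj₂ refl  = ¬P1+m

  predecessor : ∀ {a t} → P a → a ℕ.< t → P t → ∃[ s ] Adjacent P s t
  predecessor Pa (s≤s a≤t) Pt with last-≤ Pa a≤t
  ... | s , s≤t , Ps , none = s , Ps , Pt , s≤s s≤t , λ k s<k k<1+t → none k s<k (ℕP.≤-pred k<1+t)

  straddle : ∀ {a m j} → P a → a ℕ.≤ m → m ℕ.< j → P j →
             ∃₂ λ t u → Adjacent P t u × t ℕ.≤ m × m ℕ.< u × u ℕ.≤ j
  straddle {a} {m} {j} Pa a≤m = <-rec Straddles go j
    where
    Straddles : ℕ → Set
    Straddles j = m ℕ.< j → P j → ∃₂ λ t u → Adjacent P t u × t ℕ.≤ m × m ℕ.< u × u ℕ.≤ j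

    go : ∀ j → (∀ {k} → k ℕ.< j → Straddles k) → Straddles j
    go j rec m<j Pj with predecessor Pa (ℕP.≤-<-trans a≤m m<j) Pj
    ... | s , adj@(Ps , _ , s<j , _) with s ℕ.≤? m
    ...   | yes s≤m = s , j , adj , s≤m , m<j , ℕP.≤-refl
    ...   | no s≰m with rec s<j (ℕP.≰⇒> s≰m) Ps
    ...     | t , u , adj′ , t≤m , m<u , u≤s = t , u , adj′ , t≤m , m<u , ℕP.≤-trans u≤s (ℕP.<⇒≤ s<j)

get-++-< : ∀ (l : List ℤ) x {k} → k ℕ.< length l → get (l ++ x ∷ []) k ≡ get l k
get-++-< (y ∷ l) x {zero} _ = refl
get-++-< (y ∷ l) x {suc k} (s≤s k<l) = get-++-< l x k<l

get-++-length : ∀ (l : List ℤ) x → get (l ++ x ∷ []) (length l) ≡ x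
get-++-length [] x = refl
get-++-length (y ∷ l) x = get-++-length l x

module Sequence {A : Set} (ψ : Fun A) (isF : IsFunction ψ) where

  n : ℕ → ℤ
  n = nseq ψ

  d : ℕ → ℤ
  d = Δ n

  length-seqL : ∀ i → length (seqL ψ i) ≡ i
  length-seqL zero = refl
  length-seqL (suc zero) = refl
  length-seqL (suc (suc i)) = begin
    length (seqL ψ (suc i) ++ _ ∷ [])  ≡⟨ length-++ (seqL ψ (suc i)) ⟩
    length (seqL ψ (suc i)) ℕ.+ 1      ≡⟨ cong (ℕ._+ 1) (length-seqL (suc i)) ⟩
    suc i ℕ.+ 1                        ≡⟨ ℕP.+-comm (suc i) 1 ⟩
    suc (suc i)                        ∎
    where open ≡-Reasoning

  get-seqL : ∀ {k i} → k ℕ.≤ i → get (seqL ψ (suc i)) k ≡ n (suc k)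
  get-seqL {k} {i} k≤i =
    subst (λ j → get (seqL ψ (suc j)) k ≡ n (suc k)) (ℕP.m∸n+n≡m k≤i) (get-seqL′ (i ∸ k))
    where
    get-seqL′ : ∀ r → get (seqL ψ (suc (r ℕ.+ k))) k ≡ n (suc k)
    get-seqL′ zero = refl
    get-seqL′ (suc r) = trans (get-++-< (seqL ψ (suc (r ℕ.+ k))) _ k<length) (get-seqL′ r)
      where
      k<length : k ℕ.< length (seqL ψ (suc (r ℕ.+ k)))
      k<length = subst (k ℕ.<_) (sym (length-seqL _)) (s≤s (ℕP.m≤n+m k r))

  n-suc : ∀ i → n (suc (suc i)) ≡ step (seqL ψ (suc i)) (n (suc i)) (ψ (suc i))
  n-suc i = subst (λ k → get (seqL ψ (suc i) ++ x ∷ []) k ≡ x) (length-seqL (suc i))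
                  (get-++-length (seqL ψ (suc i)) x)
    where x = step (seqL ψ (suc i)) (n (suc i)) (ψ (suc i))

  ψ-inj₂-range : ∀ {i m} → ψ (suc i) ≡ inj₂ m → 1 ℕ.≤ m × m ℕ.≤ i
  ψ-inj₂-range {i} eq = subst (ValidValue (suc i)) eq (isF (suc i) (s≤s z≤n))

  n-suc-inj₁ : ∀ {i a} → ψ (suc i) ≡ inj₁ a → n (suc (suc i)) ≡ + 2 * n (suc i) + + 1
  n-suc-inj₁ {i} eq = trans (n-suc i) (cong (step (seqL ψ (suc i)) (n (suc i))) eq)

  n-suc-inj₂ : ∀ {i m} → ψ (suc i) ≡ inj₂ m → n (suc (suc i)) ≡ + 2 * n (suc i) - n m
  n-suc-inj₂ {i} {m} eq with ψ-inj₂-range eq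
  ... | s≤s {n = k} z≤n , m≤i = begin
    n (suc (suc i))                                ≡⟨ n-suc i ⟩
    step (seqL ψ (suc i)) (n (suc i)) (ψ (suc i))  ≡⟨ cong (step (seqL ψ (suc i)) (n (suc i))) eq ⟩
    + 2 * n (suc i) - get (seqL ψ (suc i)) k       ≡⟨ cong (λ x → + 2 * n (suc i) - x) (get-seqL k≤i) ⟩
    + 2 * n (suc i) - n m                          ∎
    where
    open ≡-Reasoning
    k≤i = ℕP.≤-pred (ℕP.m≤n⇒m≤1+n m≤i)

  d-inj₁ : ∀ {i a} → ψ (suc i) ≡ inj₁ a → d (suc i) ≡ n (suc i) + + 1
  d-inj₁ {i} eq = trans (cong (_- n (suc i)) (n-suc-inj₁ eq)) ([2x+1]-x≡x+1 (n (suc i)))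
    where
    [2x+1]-x≡x+1 : ∀ x → + 2 * x + + 1 - x ≡ x + + 1
    [2x+1]-x≡x+1 = solve-∀

  d-inj₂ : ∀ {i m} → ψ (suc i) ≡ inj₂ m → d (suc i) ≡ n (suc i) - n m
  d-inj₂ {i} eq = trans (cong (_- n (suc i)) (n-suc-inj₂ eq)) ([2x-y]-x≡x-y (n (suc i)) _)
    where
    [2x-y]-x≡x-y : ∀ x y → + 2 * x - y - x ≡ x - y
    [2x-y]-x≡x-y = solve-∀

  ψ-cases : ∀ i → (∃[ a ] ψ i ≡ inj₁ a) ⊎ (∃[ m ] ψ i ≡ inj₂ m)
  ψ-cases i with ψ i
  ... | inj₁ a = inj₁ (a , refl)
  ... | inj₂ m = inj₂ (m , refl)

  ψ-1 : ∃[ a ] ψ 1 ≡ inj₁ a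
  ψ-1 with ψ 1 in eq
  ... | inj₁ a = a , refl
  ... | inj₂ m with ψ-inj₂-range {0} eq
  ...   | 1≤m , m≤0 with ℕP.≤-trans 1≤m m≤0
  ...     | ()

  d-1 : d 1 ≡ + 1
  d-1 = cong (_- + 0) (n-suc-inj₁ (proj₂ ψ-1))

  -- The junk value n 0 = 0 = n 1 lets monotonicity start at index 0.
  d-nonneg-step : ∀ l → (∀ {k} → k ℕ.≤ l → n k ≤ n l) → + 0 ≤ d l
  d-nonneg-step zero _ = ℤP.≤-refl
  d-nonneg-step (suc l) n-mono-upto with ψ-cases (suc l)
  ... | inj₁ (_ , eq) =
    subst (+ 0 ≤_) (sym (d-inj₁ eq)) (ℤP.≤-trans (n-mono-upto z≤n) (ℤP.i≤i+j _ (+ 1)))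
  ... | inj₂ (_ , eq) = subst (+ 0 ≤_) (sym (d-inj₂ eq))
                          (ℤP.i≤j⇒0≤j-i (n-mono-upto (ℕP.m≤n⇒m≤1+n (proj₂ (ψ-inj₂-range eq)))))

  n-mono : ∀ {k l} → k ℕ.≤ l → n k ≤ n l
  n-mono {l = zero} z≤n = ℤP.≤-refl
  n-mono {l = suc l} k≤1+l with ℕP.m≤n⇒m<n∨m≡n k≤1+l
  ... | inj₁ k<1+l = ℤP.≤-trans (n-mono (ℕP.≤-pred k<1+l)) (ℤP.0≤i-j⇒j≤i (d-nonneg-step l n-mono))
  ... | inj₂ refl  = ℤP.≤-refl

  n-nonneg : ∀ l → + 0 ≤ n l
  n-nonneg l = n-mono {0} {l} z≤n

  d-nonneg : ∀ l → + 0 ≤ d l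
  d-nonneg l = d-nonneg-step l n-mono

  -n≤1 : ∀ l → - n l ≤ + 1
  -n≤1 l = ℤP.neg-mono-≤ (ℤP.≤-trans ℤ.-≤+ (n-nonneg l))

  n-convex : ∀ l → d l ≤ d (suc l)
  n-convex l with ψ-cases (suc l)
  ... | inj₁ (_ , eq) = subst (d l ≤_) (sym (d-inj₁ eq))
                          (ℤP.+-monoʳ-≤ (n (suc l)) (-n≤1 l))
  ... | inj₂ (_ , eq) = subst (d l ≤_) (sym (d-inj₂ eq))
                          (ℤP.+-monoʳ-≤ (n (suc l)) (ℤP.neg-mono-≤ (n-mono (proj₂ (ψ-inj₂-range eq)))))

  open ConvexSequence n n-convex public

  d-pos : ∀ {l} → 1 ℕ.≤ l → + 0 < d l
  d-pos {l} 1≤l = ℤP.suc[i]≤j⇒i<j {+ 0} (subst (_≤ d l) d-1 (Δ-mono 1≤l))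

  n-≥-pred : ∀ i → + (i ∸ 1) ≤ n i
  n-≥-pred zero = ℤP.≤-refl
  n-≥-pred (suc r) = begin
    + r                        ≡⟨ ℤP.*-identityʳ (+ r) ⟨
    + r * + 1                  ≡⟨ cong (+ r *_) d-1 ⟨
    + r * d 1                  ≡⟨ ℤP.+-identityˡ _ ⟨
    n 1 + + (suc r ∸ 1) * d 1  ≤⟨ secant-≥ {1} {suc r} (s≤s z≤n) ⟩
    n (suc r)                  ∎
    where open ℤP.≤-Reasoning

  n-pos : ∀ {i} → 2 ℕ.≤ i → + 1 ≤ n i
  n-pos {i} 2≤i = ℤP.≤-trans (+≤+ (ℕP.∸-monoˡ-≤ 1 2≤i)) (n-≥-pred i)

  gap-≤ : ∀ {a b k} → 1 ℕ.≤ a → a ℕ.≤ b → n b ≤ + k * d a → b ∸ a ℕ.≤ k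
  gap-≤ {a} {b} {k} 1≤a a≤b nb≤k*da =
    ℤP.drop‿+≤+ (ℤP.*-cancelʳ-≤-pos (+ (b ∸ a)) (+ k) (d a) {{ℤ.positive (d-pos 1≤a)}} (begin
      + (b ∸ a) * d a          ≤⟨ ℤP.i≤j+i _ (n a) {{ℤ.nonNegative (n-nonneg a)}} ⟩
      n a + + (b ∸ a) * d a    ≤⟨ secant-≥ a≤b ⟩
      n b                      ≤⟨ nb≤k*da ⟩
      + k * d a                ∎))
    where open ℤP.≤-Reasoning

  n-suc-≤-3* : ∀ {l} → 2 ℕ.≤ l → n (suc l) ≤ + 3 * n l
  n-suc-≤-3* {suc l} 2≤l = begin
    n (suc (suc l))                   ≤⟨ n-suc-≤-2*+1 ⟩
    + 2 * n (suc l) + + 1             ≤⟨ ℤP.+-monoʳ-≤ (+ 2 * n (suc l)) (n-pos 2≤l) ⟩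
    + 2 * n (suc l) + n (suc l)       ≡⟨ 2x+x≡3x (n (suc l)) ⟩
    + 3 * n (suc l)                   ∎
    where
    open ℤP.≤-Reasoning
    2x+x≡3x : ∀ x → + 2 * x + x ≡ + 3 * x
    2x+x≡3x = solve-∀
    n-suc-≤-2*+1 : n (suc (suc l)) ≤ + 2 * n (suc l) + + 1
    n-suc-≤-2*+1 with ψ-cases (suc l)
    ... | inj₁ (_ , eq) = ℤP.≤-reflexive (n-suc-inj₁ eq)
    ... | inj₂ (m , eq) = subst (_≤ + 2 * n (suc l) + + 1) (sym (n-suc-inj₂ eq))
                            (ℤP.+-monoʳ-≤ (+ 2 * n (suc l)) (-n≤1 m))

  inT? : Decidable (InT ψ)
  inT? l = (1 ℕ.≤? l) ×-dec value? (ψ l)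
    where
    value? : (v : A ⊎ ℕ) → Dec (∃[ a ] v ≡ inj₁ a ⊎ ∃[ m ] (v ≡ inj₂ m × 1 ℕ.≤ m × m ℕ.≤ l ∸ 2))
    value? (inj₁ a) = yes (inj₁ (a , refl))
    value? (inj₂ m) with (1 ℕ.≤? m) ×-dec (m ℕ.≤? l ∸ 2)
    ... | yes m-in-range = yes (inj₂ (m , refl , m-in-range))
    ... | no ¬m-in-range =
      no λ { (inj₁ (_ , ())) ; (inj₂ (_ , refl , m-in-range)) → ¬m-in-range m-in-range }

  1∈T : InT ψ 1
  1∈T = s≤s z≤n , inj₁ ψ-1

  ∉T⇒ψ≡pred : ∀ {l} → ¬ InT ψ (suc l) → ψ (suc l) ≡ inj₂ l
  ∉T⇒ψ≡pred {l} ∉T with ψ (suc l) in eq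
  ... | inj₁ a = ⊥-elim (∉T (s≤s z≤n , inj₁ (a , refl)))
  ... | inj₂ m with ψ-inj₂-range eq | m ℕ.≤? l ∸ 1
  ...   | 1≤m , m≤l | yes m≤l-1 = ⊥-elim (∉T (s≤s z≤n , inj₂ (m , refl , 1≤m , m≤l-1)))
  ...   | 1≤m , m≤l | no m≰l-1 =
    cong inj₂ (ℕP.≤-antisym m≤l (ℕP.≤-trans (ℕP.m≤n+m∸n l 1) (ℕP.≰⇒> m≰l-1)))

  module Backward (B : ℤ) (N : ℕ)
                  (close : ∀ i → N ℕ.≤ i → ∃[ m ] (ψ i ≡ inj₂ m × + i - B ≤ + m)) where

    b : ℕ
    b = ∣ B ∣

    q : ℕ
    q = 3 ^ b

    p : ℕ
    p = ℕ.pred (2 ℕ.* q)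

    1+p≡2q : suc p ≡ 2 ℕ.* q
    1+p≡2q = ℕP.suc-pred (2 ℕ.* q) {{ℕ.>-nonZero (ℕP.*-monoʳ-< 2 (ℕP.m^n>0 3 b))}}

    p<2q : p ℕ.< 2 ℕ.* q
    p<2q = ℕP.≤-reflexive 1+p≡2q

    i₀ : ℕ
    i₀ = 2 ℕ.+ b ℕ.+ N

    ratio : ∀ i → i₀ ℕ.≤ i → + 0 < n i × + q * n (suc i) ≤ + p * n i
    ratio (suc i) i₀≤1+i with close (suc i) (ℕP.≤-trans (ℕP.m≤n+m N (2 ℕ.+ b)) i₀≤1+i)
    ... | m , eq , 1+i-B≤m = ℤP.suc[i]≤j⇒i<j {+ 0} (n-pos 2≤1+i) , (begin
      + q * n (suc (suc i))            ≡⟨ cong (+ q *_) (n-suc-inj₂ eq) ⟩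
      + q * (+ 2 * x - n m)            ≡⟨ *-distrib-2x-y (+ q) x (n m) ⟩
      + q * (+ 2 * x) - + q * n m      ≤⟨ ℤP.+-monoʳ-≤ (+ q * (+ 2 * x)) (ℤP.neg-mono-≤ x≤q*nm) ⟩
      + q * (+ 2 * x) - x              ≡⟨ cong (_- x) (q*[2*x]≡[2q]*x q x) ⟩
      + (2 ℕ.* q) * x - x              ≡⟨ cong (λ k → + k * x - x) 1+p≡2q ⟨
      + suc p * x - x                  ≡⟨ cong (_- x) ([1+p]*x≡p*x+x p x) ⟩
      + p * x + x - x                  ≡⟨ x+y-y≡x (+ p * x) x ⟩
      + p * x                          ∎)
      where
      open ℤP.≤-Reasoning
      x = n (suc i)
      2+b≤1+i : 2 ℕ.+ b ℕ.≤ suc i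
      2+b≤1+i = ℕP.≤-trans (ℕP.m≤m+n (2 ℕ.+ b) N) i₀≤1+i
      2≤1+i : 2 ℕ.≤ suc i
      2≤1+i = ℕP.≤-trans (ℕP.m≤m+n 2 b) 2+b≤1+i
      1+i≤m+b : suc i ℕ.≤ m ℕ.+ b
      1+i≤m+b = +i-B≤+m⇒i≤m+∣B∣ B 1+i-B≤m
      2≤m : 2 ℕ.≤ m
      2≤m = ℕP.+-cancelʳ-≤ b 2 m (ℕP.≤-trans 2+b≤1+i 1+i≤m+b)
      m≤1+i : m ℕ.≤ suc i
      m≤1+i = ℕP.m≤n⇒m≤1+n (proj₂ (ψ-inj₂-range eq))
      x≤q*nm : x ≤ + q * n m
      x≤q*nm = begin
        x                               ≤⟨ geometric-≤ n 3 (λ k m≤k → n-suc-≤-3* (ℕP.≤-trans 2≤m m≤k)) m≤1+i ⟩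
        + (3 ^ (suc i ∸ m)) * n m       ≤⟨ ℤP.*-monoʳ-≤-nonNeg (n m) {{ℤ.nonNegative (n-nonneg m)}}
                                             (+≤+ (ℕP.^-monoʳ-≤ 3 (ℕP.m≤n+o⇒m∸n≤o (suc i) m 1+i≤m+b))) ⟩
        + q * n m                       ∎
      *-distrib-2x-y : ∀ q x y → q * (+ 2 * x - y) ≡ q * (+ 2 * x) - q * y
      *-distrib-2x-y = solve-∀

module ReducedSequence {A : Set} (ψ : Fun A) (red : Reduced ψ) where

  open Sequence ψ (proj₁ red)
  open BoundedSearch inT?

  below-prev : ∀ {s t m} → Consecutive ψ s t → ψ t ≡ inj₂ m → m ℕ.< s
  below-prev {s} adj eq = subst (BelowPrev s) eq (proj₂ (proj₂ red _ _ adj))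

  n-pred-≤-d : ∀ {t} → InT ψ t → n (ℕ.pred t) ≤ d t
  n-pred-≤-d {t} = <-rec (λ t → InT ψ t → n (ℕ.pred t) ≤ d t) go t
    where
    open ℤP.≤-Reasoning
    y-[y-x]≡x : ∀ x y → y - (y - x) ≡ x
    y-[y-x]≡x = solve-∀

    go : ∀ t → (∀ {s} → s ℕ.< t → InT ψ s → n (ℕ.pred s) ≤ d s) → InT ψ t → n (ℕ.pred t) ≤ d t
    go (suc t) rec t∈T with ψ-cases (suc t)
    ... | inj₁ (_ , eq) =
      subst (n t ≤_) (sym (d-inj₁ eq)) (ℤP.≤-trans (n-mono (ℕP.n≤1+n t)) (ℤP.i≤i+j (n (suc t)) (+ 1)))
    ... | inj₂ (m , eq) with ψ-inj₂-range eq
    ...   | 1≤m , m≤t with predecessor 1∈T (s≤s (ℕP.≤-trans 1≤m m≤t)) t∈T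
    ...     | s , adj@(s∈T , _ , s<1+t , _) = begin
      n t                ≡⟨ y-[y-x]≡x (n t) (n (suc t)) ⟨
      n (suc t) - d t    ≤⟨ ℤP.+-monoʳ-≤ (n (suc t)) (ℤP.neg-mono-≤ nm≤dt) ⟩
      n (suc t) - n m    ≡⟨ d-inj₂ eq ⟨
      d (suc t)          ∎
      where
      nm≤dt : n m ≤ d t
      nm≤dt = begin
        n m              ≤⟨ n-mono (ℕP.<⇒≤pred (below-prev adj eq)) ⟩
        n (ℕ.pred s)     ≤⟨ rec s<1+t s∈T ⟩
        d s              ≤⟨ Δ-mono (ℕP.≤-pred s<1+t) ⟩
        d t              ∎

  n-≤-d+d : ∀ {t} → InT ψ t → n t ≤ d t + d t
  n-≤-d+d {suc t} t∈T = begin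
    n (suc t)              ≡⟨ +Δ≡suc n t ⟨
    n t + d t              ≤⟨ ℤP.+-mono-≤ (n-pred-≤-d t∈T) (n-convex t) ⟩
    d (suc t) + d (suc t)  ∎
    where open ℤP.≤-Reasoning

  module Forward (p q : ℕ) (p<2q : p ℕ.< 2 ℕ.* q) (N : ℕ)
                 (ratio : ∀ i → N ℕ.≤ i → + 0 < n i × + q * n (suc i) ≤ + p * n i) where

    open ℤP.≤-Reasoning

    ratio-slack : ∀ {i} → N ℕ.≤ i → + 0 ≤ + q * (+ 2 * n i) - (+ q * n (suc i) + n i)
    ratio-slack {i} N≤i = ℤP.i≤j⇒0≤j-i (begin
      + q * n (suc i) + n i    ≤⟨ ℤP.+-monoˡ-≤ (n i) (proj₂ (ratio i N≤i)) ⟩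
      + p * n i + n i          ≡⟨ [1+p]*x≡p*x+x p (n i) ⟨
      + suc p * n i            ≤⟨ ℤP.*-monoʳ-≤-nonNeg (n i) {{ℤ.nonNegative (n-nonneg i)}} (+≤+ p<2q) ⟩
      + (2 ℕ.* q) * n i        ≡⟨ q*[2*x]≡[2q]*x q (n i) ⟨
      + q * (+ 2 * n i)        ∎)

    ψ-beyond-N : ∀ {i} → N ℕ.≤ i → ∃[ m ] (ψ i ≡ inj₂ m × n i ≤ + q * n m)
    ψ-beyond-N {zero} N≤0 = ⊥-elim (ℤP.<-irrefl refl (proj₁ (ratio 0 N≤0)))
    ψ-beyond-N {suc i} N≤1+i with ψ-cases (suc i)
    ... | inj₁ (_ , eq) = ⊥-elim (ℤP.<⇒≱ 0<q+x q+x≤0)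
      where
      x = n (suc i)
      0<q+x : + 0 < + q + x
      0<q+x = ℤP.<-≤-trans (proj₁ (ratio (suc i) N≤1+i)) (ℤP.i≤j+i x (+ q))
      slack≡ : + q * (+ 2 * x) - (+ q * n (suc (suc i)) + x) ≡ + 0 - (+ q + x)
      slack≡ = trans (cong (λ y → + q * (+ 2 * x) - (+ q * y + x)) (n-suc-inj₁ eq)) (identity (+ q) x)
        where
        identity : ∀ q x → q * (+ 2 * x) - (q * (+ 2 * x + + 1) + x) ≡ + 0 - (q + x)
        identity = solve-∀
      q+x≤0 : + q + x ≤ + 0
      q+x≤0 = ℤP.0≤i-j⇒j≤i (subst (+ 0 ≤_) slack≡ (ratio-slack N≤1+i))
    ... | inj₂ (m , eq) = m , eq , ℤP.0≤i-j⇒j≤i (subst (+ 0 ≤_) slack≡ (ratio-slack N≤1+i))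
      where
      x = n (suc i)
      slack≡ : + q * (+ 2 * x) - (+ q * n (suc (suc i)) + x) ≡ + q * n m - x
      slack≡ = trans (cong (λ y → + q * (+ 2 * x) - (+ q * y + x)) (n-suc-inj₂ eq)) (identity (+ q) x (n m))
        where
        identity : ∀ q x y → q * (+ 2 * x) - (q * (+ 2 * x - y) + x) ≡ q * y - x
        identity = solve-∀

    adjacent-gap-≤ : ∀ {t u} → Consecutive ψ t u → N ℕ.≤ u → u ∸ t ℕ.≤ q
    adjacent-gap-≤ {t} {u} adj@(t∈T , _ , t<u , _) N≤u with ψ-beyond-N N≤u
    ... | m , eq , nu≤q*nm = gap-≤ (proj₁ t∈T) (ℕP.<⇒≤ t<u) (begin
      n u                 ≤⟨ nu≤q*nm ⟩
      + q * n m           ≤⟨ ℤP.*-monoˡ-≤-nonNeg (+ q) (n-mono (ℕP.<⇒≤pred (below-prev adj eq))) ⟩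
      + q * n (ℕ.pred t)  ≤⟨ ℤP.*-monoˡ-≤-nonNeg (+ q) (n-pred-≤-d t∈T) ⟩
      + q * d t           ∎)

    n-≤-[q+2]*d : ∀ {t u m} → Consecutive ψ t u → t ℕ.≤ m → m ℕ.< u → N ℕ.≤ u →
                  n m ≤ + (q ℕ.+ 2) * d m
    n-≤-[q+2]*d {t} {u} {m} adj@(t∈T , _) t≤m m<u N≤u = begin
      n m                           ≤⟨ secant-≤ t≤m ⟩
      n t + + (m ∸ t) * d m         ≤⟨ ℤP.+-mono-≤ (n-≤-d+d t∈T) [m-t]*dm≤q*dm ⟩
      d t + d t + + q * d m         ≤⟨ ℤP.+-monoˡ-≤ (+ q * d m) (ℤP.+-mono-≤ (Δ-mono t≤m) (Δ-mono t≤m)) ⟩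
      d m + d m + + q * d m         ≡⟨ identity (+ q) (d m) ⟩
      (+ q + + 2) * d m             ∎
      where
      m∸t≤q : m ∸ t ℕ.≤ q
      m∸t≤q = ℕP.≤-trans (ℕP.∸-monoˡ-≤ t (ℕP.<⇒≤ m<u)) (adjacent-gap-≤ adj N≤u)
      [m-t]*dm≤q*dm : + (m ∸ t) * d m ≤ + q * d m
      [m-t]*dm≤q*dm = ℤP.*-monoʳ-≤-nonNeg (d m) {{ℤ.nonNegative (d-nonneg m)}} (+≤+ m∸t≤q)
      identity : ∀ q x → x + x + q * x ≡ (q + + 2) * x
      identity = solve-∀

    gap-at-T : ∀ {j m} → InT ψ j → ψ j ≡ inj₂ m → N ℕ.≤ m → n j ≤ + q * n m →
               j ∸ m ℕ.≤ q ℕ.* (q ℕ.+ 2)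
    gap-at-T {suc j} {m} j∈T eq N≤m nj≤q*nm with ψ-inj₂-range eq
    ... | 1≤m , m≤j with straddle 1∈T 1≤m (s≤s m≤j) j∈T
    ...   | t , u , adj , t≤m , m<u , u≤1+j = gap-≤ 1≤m (ℕP.m≤n⇒m≤1+n m≤j) (begin
      n (suc j)                          ≤⟨ nj≤q*nm ⟩
      + q * n m                          ≤⟨ ℤP.*-monoˡ-≤-nonNeg (+ q) nm≤[q+2]*dm ⟩
      + q * (+ (q ℕ.+ 2) * d m)          ≡⟨ ℤP.*-assoc (+ q) (+ (q ℕ.+ 2)) (d m) ⟨
      + q * + (q ℕ.+ 2) * d m            ≡⟨ cong (_* d m) (ℤP.pos-* q (q ℕ.+ 2)) ⟨
      + (q ℕ.* (q ℕ.+ 2)) * d m          ∎)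
      where nm≤[q+2]*dm = n-≤-[q+2]*d adj t≤m m<u (ℕP.≤-trans N≤m (ℕP.<⇒≤ m<u))

    K : ℕ
    K = ∣ n N ∣

    j₀ : ℕ
    j₀ = 2 ℕ.+ q ℕ.* K ℕ.+ N

    B : ℕ
    B = suc (q ℕ.* (q ℕ.+ 2))

    large-j⇒N≤m : ∀ {j m} → j₀ ℕ.≤ j → n j ≤ + q * n m → N ℕ.≤ m
    large-j⇒N≤m {j} {m} j₀≤j nj≤q*nm with N ℕ.≤? m
    ... | yes N≤m = N≤m
    ... | no N≰m = ⊥-elim (ℕP.<⇒≱ qK<j-1 (ℤP.drop‿+≤+ (begin
      + (j ∸ 1)     ≤⟨ n-≥-pred j ⟩
      n j           ≤⟨ nj≤q*nm ⟩
      + q * n m     ≤⟨ ℤP.*-monoˡ-≤-nonNeg (+ q) (n-mono (ℕP.<⇒≤ (ℕP.≰⇒> N≰m))) ⟩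
      + q * n N     ≡⟨ cong (+ q *_) (ℤP.0≤i⇒+∣i∣≡i (n-nonneg N)) ⟨
      + q * + K     ≡⟨ ℤP.pos-* q K ⟨
      + (q ℕ.* K)   ∎)))
      where
      qK<j-1 : q ℕ.* K ℕ.< j ∸ 1
      qK<j-1 = ℕP.≤-trans (s≤s (ℕP.m≤m+n (q ℕ.* K) N)) (ℕP.∸-monoˡ-≤ 1 j₀≤j)

    close : ∀ j → j₀ ℕ.≤ j → ∃[ m ] (ψ j ≡ inj₂ m × + j - + B ≤ + m)
    close (suc j) j₀≤1+j with ψ-beyond-N (ℕP.≤-trans (ℕP.m≤n+m N (2 ℕ.+ q ℕ.* K)) j₀≤1+j)
    ... | m , eq , nj≤q*nm = m , eq , i≤m+b⇒+i-+b≤+m (close-ℕ (inT? (suc j)))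
      where
      close-ℕ : Dec (InT ψ (suc j)) → suc j ℕ.≤ m ℕ.+ B
      close-ℕ (yes j∈T) = ℕP.≤-trans (ℕP.m≤n+m∸n (suc j) m)
        (ℕP.+-monoʳ-≤ m (ℕP.m≤n⇒m≤1+n (gap-at-T j∈T eq (large-j⇒N≤m j₀≤1+j nj≤q*nm) nj≤q*nm)))
      close-ℕ (no j∉T) rewrite inj₂-injective (trans (sym (∉T⇒ψ≡pred j∉T)) eq) =
        subst (suc m ℕ.≤_) (sym (ℕP.+-suc m _)) (s≤s (ℕP.m≤m+n m _))

DeltaLt2⇒EventuallyClose : ∀ {A} {ψ : Fun A} → Reduced ψ → DeltaLt2 ψ → EventuallyClose ψ
DeltaLt2⇒EventuallyClose {ψ = ψ} red (p , q , p<2q , N , ratio) = + B , j₀ , close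
  where
  open ReducedSequence ψ red
  open Forward p q p<2q N ratio

EventuallyClose⇒DeltaLt2 : ∀ {A} {ψ : Fun A} → IsFunction ψ → EventuallyClose ψ → DeltaLt2 ψ
EventuallyClose⇒DeltaLt2 {ψ = ψ} isF (B , N , close) = p , q , p<2q , i₀ , ratio
  where
  open Sequence ψ isF
  open Backward B N close

lemma9p2 : (A : Set) (ψ : Fun A) → Reduced ψ → DeltaLt2 ψ ⇔ EventuallyClose ψ
lemma9p2 A ψ red = mk⇔ (DeltaLt2⇒EventuallyClose red) (EventuallyClose⇒DeltaLt2 (proj₁ red))
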